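{- Let $X=(x_{i,j})$ and $Y=(y_{i,j})$ be independent uniformly random symmetric $d\times d$ matrices over $\mathbb{F}_q$ (so $x_{i,j}=x_{j,i}$, $y_{i,j}=y_{j,i}$). Define the $d\times d$ matrix $Z$ by $Z_{i,j}=x_{i,j}+y_{i,j+1}$ for $1\leq j\leq d-1$ and $Z_{i,d}=x_{i,d}+y_{i,1}$ (that is, $Z=X+Y\Pi$ where $\Pi$ is the permutation matrix cyclically shifting column $j+1$ to column $j$). Then $Z$ is a uniformly distributed random matrix in $\mathrm{M}(d,\mathbb{F}_q)$.
   Context: $\mathrm{M}(d,\mathbb{F}_q)$ is the space of $d\times d$ matrices over $\mathbb{F}_q$. Explicitly, the rows of $Z$ are $(x_{1,1}+y_{1,2}, x_{1,2}+y_{1,3},\dots,x_{1,d}+y_{1,1})$, $(x_{1,2}+y_{2,2}, x_{2,2}+y_{2,3},\dots,x_{2,d}+y_{1,2})$, $\dots$, $(x_{1,d}+y_{2,d}, x_{2,d}+y_{3,d},\dots,x_{d,d}+y_{1,d})$. -}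

module Defs where

open import Level using (Level; _⊔_) renaming (suc to lsuc)
open import Data.Nat using (ℕ; zero; suc; NonZero)
open import Data.Nat.DivMod using (_%_; m%n<n)
open import Data.Fin using (Fin; toℕ; fromℕ<) renaming (zero to fz; suc to fs)
open import Data.List using (List; []; _∷_; [_]; map; concatMap; filter; length; cartesianProduct)
open import Data.List.Relation.Unary.Any using (Any)
open import Data.List.Relation.Unary.AllPairs using (AllPairs)
open import Data.Product using (_×_; _,_; proj₁; proj₂; ∃)
open import Relation.Nullary using (¬_; Dec; yes; no)
open import Relation.Binary using (Decidable)
open import Relation.Unary using () renaming (Decidable to UDecidable)
open import Algebra.Bundles using (CommutativeRing)

record FiniteField c ℓ : Set (lsuc (c ⊔ ℓ)) where
  field
    commRing : CommutativeRing c ℓ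
  open CommutativeRing commRing public
  field
    1≉0      : ¬ (1# ≈ 0#)
    inverse  : ∀ x → ¬ (x ≈ 0#) → ∃ λ y → x * y ≈ 1#
    _≟_      : Decidable _≈_
    elems    : List Carrier
    complete : ∀ x → Any (x ≈_) elems
    distinct : AllPairs (λ a b → ¬ (a ≈ b)) elems

  order : ℕ
  order = length elems

cons : ∀ {a} {A : Set a} {n : ℕ} → A → (Fin n → A) → Fin (suc n) → A
cons x f fz     = x
cons x f (fs i) = f i

allFuns : ∀ {a} {A : Set a} (n : ℕ) → List A → List (Fin n → A)
allFuns zero    xs = [ (λ ()) ]
allFuns (suc n) xs = concatMap (λ x → map (cons x) (allFuns n xs)) xs

next : ∀ {d} → Fin d → Fin d
next {suc d} j = fromℕ< (m%n<n (suc (toℕ j)) (suc d))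

count : ∀ {a p} {A : Set a} {P : A → Set p} → UDecidable P → List A → ℕ
count P? xs = length (filter P? xs)

allFin? : ∀ {p} (n : ℕ) {P : Fin n → Set p} → (∀ i → Dec (P i)) → Dec (∀ i → P i)
allFin? zero    P? = yes (λ ())
allFin? (suc n) P? with P? fz | allFin? n (λ i → P? (fs i))
... | yes p | yes q = yes λ { fz → p ; (fs i) → q i }
... | no ¬p | _     = no λ h → ¬p (h fz)
... | yes _ | no ¬q = no λ h → ¬q (λ i → h (fs i))

module _ {c ℓ} (F : FiniteField c ℓ) where
  open FiniteField F

  Mat : ℕ → Set c
  Mat d = Fin d → Fin d → Carrier

  allMats : (d : ℕ) → List (Mat d)
  allMats d = allFuns d (allFuns d elems)

  Symmetric : ∀ {d} → Mat d → Set ℓ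
  Symmetric {d} X = ∀ i j → X i j ≈ X j i

  symmetric? : ∀ {d} → UDecidable (Symmetric {d})
  symmetric? {d} X = allFin? d λ i → allFin? d λ j → X i j ≟ X j i

  symMats : (d : ℕ) → List (Mat d)
  symMats d = filter symmetric? (allMats d)

  Zmat : ∀ {d} → Mat d → Mat d → Mat d
  Zmat X Y i j = X i j + Y i (next j)

  MatEq : ∀ {d} → Mat d → Mat d → Set ℓ
  MatEq {d} A B = ∀ i j → A i j ≈ B i j

  matEq? : ∀ {d} → Decidable (MatEq {d})
  matEq? {d} A B = allFin? d λ i → allFin? d λ j → A i j ≟ B i j

  fiberCount : (d : ℕ) → Mat d → ℕ
  fiberCount d M =
    count (λ XY → matEq? (Zmat (proj₁ XY) (proj₂ XY)) M)
          (cartesianProduct (symMats d) (symMats d))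

-- The map (X , Y) ↦ X + YΠ is additive. Once it is known to be surjective onto
-- M(d, F), translating by a preimage (X₀ , Y₀) of M is a bijection of the
-- pairs of symmetric matrices carrying the fibre over 0 onto the fibre over M,
-- so all fibres have the same size, and summing over M gives
-- fibre · |M(d, F)| = |Sym|².
--
-- Surjectivity: X = M − YΠ is symmetric iff Y(i, j+1) − Y(j, i+1) = M(i, j) − M(j, i)
-- for all i, j (indices mod d). Putting A = M − Mᵀ and
-- Y(a, b) = Σ_{k<a} A(a+b−1−k, k), we get Y(a+1, b) = Y(a, b+1) + A(b, a), while
-- Y(a, b) = Y(b, a) because the terms of the alternating form A along an
-- anti-diagonal cancel in pairs, the middle term A(x, x) being 0.
module Submission where

open import Defs
open import Level using (Level; _⊔_)
open import Algebra.Bundles using (CommutativeMonoid; AbelianGroup)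
open import Data.Nat as ℕ using (ℕ; zero; suc; _*_; _∸_; _<_; s≤s)
import Data.Nat.Properties as ℕ
open import Data.Nat.DivMod using (_mod_; _%_; [m+n]%n≡m%n; m<n⇒m%n≡m; n%n≡0)
open import Data.Nat.ListAction using (sum)
open import Data.Nat.Tactic.RingSolver using () renaming (solve-∀ to ℕ-solve-∀)
open import Data.Fin using (Fin; toℕ) renaming (zero to fz; suc to fs)
open import Data.Fin.Properties using (toℕ-fromℕ<; fromℕ<-cong; fromℕ<-toℕ; toℕ<n)
open import Data.List using (List; []; _∷_; _++_; map; concatMap; filter; length; cartesianProduct)
open import Data.List.Relation.Unary.All as All using (All; []; _∷_)
open import Data.List.Relation.Unary.All.Properties using (map⁺; ++⁺; all-filter)
open import Data.List.Relation.Unary.Any using (Any; here; there)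
open import Data.List.Relation.Unary.AllPairs using (AllPairs; []; _∷_)
open import Data.Product using (_×_; _,_; ∃; proj₁; proj₂; uncurry)
import Data.Product as Product
open import Data.Product.Relation.Binary.Pointwise.NonDependent using (×-decSetoid)
open import Data.Sum using (inj₁; inj₂)
open import Data.Empty using (⊥-elim)
import Data.Vec.Functional.Relation.Binary.Pointwise.Properties as Pointwise
open import Function using (_∘_; _⇔_; mk⇔; Equivalence)
open import Relation.Binary using (DecSetoid; _Preserves_⟶_; _Respects_)
open import Relation.Nullary using (¬_; Dec; yes; no; _×-dec_)
open import Relation.Unary using (Pred; U; _⟨×⟩_) renaming (Decidable to UDecidable)
open import Relation.Binary.PropositionalEquality as ≡ using (_≡_)

module ListSum where
  open ≡ using (refl; cong; cong₂)
  open import Data.Nat using (_+_)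
  open import Data.List.Properties using (map-++; map-∘; map-cong; map-cong-local; length-++; length-map)
  open import Data.Nat.ListAction.Properties using (sum-++)
  open import Algebra.Properties.CommutativeSemigroup ℕ.+-commutativeSemigroup using (interchange)

  private variable
    a b : Level
    A : Set a
    B : Set b

  𝟙 : ∀ {p} {P : Set p} → Dec P → ℕ
  𝟙 (yes _) = 1
  𝟙 (no _)  = 0

  𝟙-cong : ∀ {p q} {P : Set p} {Q : Set q} (p? : Dec P) (q? : Dec Q) → P ⇔ Q → 𝟙 p? ≡ 𝟙 q?
  𝟙-cong (yes _) (yes _) _   = refl
  𝟙-cong (no _)  (no _)  _   = refl
  𝟙-cong (yes p) (no ¬q) p⇔q = ⊥-elim (¬q (Equivalence.to p⇔q p))
  𝟙-cong (no ¬p) (yes q) p⇔q = ⊥-elim (¬p (Equivalence.from p⇔q q))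

  𝟙-×-dec : ∀ {p q} {P : Set p} {Q : Set q} (p? : Dec P) (q? : Dec Q) → 𝟙 (p? ×-dec q?) ≡ 𝟙 p? * 𝟙 q?
  𝟙-×-dec (yes _) (yes _) = refl
  𝟙-×-dec (yes _) (no _)  = refl
  𝟙-×-dec (no _)  _       = refl

  ∑ : List A → (A → ℕ) → ℕ
  ∑ xs f = sum (map f xs)

  syntax ∑ xs (λ x → e) = ∑[ x ∈ xs ] e

  ∑-cong : ∀ (xs : List A) {f g : A → ℕ} → (∀ x → f x ≡ g x) → ∑ xs f ≡ ∑ xs g
  ∑-cong xs f≗g = cong sum (map-cong f≗g xs)

  ∑-congᴬ : ∀ {xs : List A} {f g : A → ℕ} → All (λ x → f x ≡ g x) xs → ∑ xs f ≡ ∑ xs g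
  ∑-congᴬ eqs = cong sum (map-cong-local eqs)

  ∑-++ : ∀ (xs ys : List A) f → ∑ (xs ++ ys) f ≡ ∑ xs f + ∑ ys f
  ∑-++ xs ys f = ≡.trans (cong sum (map-++ f xs ys)) (sum-++ (map f xs) (map f ys))

  ∑-map : ∀ (g : B → A) xs f → ∑ (map g xs) f ≡ ∑ xs (f ∘ g)
  ∑-map g xs f = ≡.sym (cong sum (map-∘ xs))

  ∑-concatMap : ∀ (g : A → List B) xs f → ∑ (concatMap g xs) f ≡ ∑[ x ∈ xs ] ∑ (g x) f
  ∑-concatMap g []       f = refl
  ∑-concatMap g (x ∷ xs) f =
    ≡.trans (∑-++ (g x) (concatMap g xs) f) (cong (∑ (g x) f +_) (∑-concatMap g xs f))

  ∑-filter : ∀ {p} {P : A → Set p} (P? : UDecidable P) xs f →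
             ∑ (filter P? xs) f ≡ ∑[ x ∈ xs ] (𝟙 (P? x) * f x)
  ∑-filter P? []       f = refl
  ∑-filter P? (x ∷ xs) f with P? x
  ... | yes _ = cong₂ _+_ (≡.sym (ℕ.+-identityʳ (f x))) (∑-filter P? xs f)
  ... | no  _ = ∑-filter P? xs f

  ∑-const : ∀ (xs : List A) c → ∑[ _ ∈ xs ] c ≡ length xs * c
  ∑-const []       c = refl
  ∑-const (x ∷ xs) c = cong (c +_) (∑-const xs c)

  ∑-*ˡ : ∀ (xs : List A) c f → ∑[ x ∈ xs ] (c * f x) ≡ c * ∑ xs f
  ∑-*ˡ []       c f = ≡.sym (ℕ.*-zeroʳ c)
  ∑-*ˡ (x ∷ xs) c f = ≡.trans (cong (c * f x +_) (∑-*ˡ xs c f)) (≡.sym (ℕ.*-distribˡ-+ c (f x) (∑ xs f)))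

  ∑-*ʳ : ∀ (xs : List A) f c → ∑[ x ∈ xs ] (f x * c) ≡ ∑ xs f * c
  ∑-*ʳ []       f c = refl
  ∑-*ʳ (x ∷ xs) f c = ≡.trans (cong (f x * c +_) (∑-*ʳ xs f c)) (≡.sym (ℕ.*-distribʳ-+ c (f x) (∑ xs f)))

  ∑-+ : ∀ (xs : List A) f g → ∑[ x ∈ xs ] (f x + g x) ≡ ∑ xs f + ∑ xs g
  ∑-+ []       f g = refl
  ∑-+ (x ∷ xs) f g = ≡.trans (cong (f x + g x +_) (∑-+ xs f g)) (interchange (f x) (g x) (∑ xs f) (∑ xs g))

  ∑-swap : ∀ (xs : List A) (ys : List B) (f : A → B → ℕ) →
           ∑[ x ∈ xs ] ∑[ y ∈ ys ] f x y ≡ ∑[ y ∈ ys ] ∑[ x ∈ xs ] f x y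
  ∑-swap []       ys f = ≡.sym (≡.trans (∑-const ys 0) (ℕ.*-zeroʳ (length ys)))
  ∑-swap (x ∷ xs) ys f = ≡.trans (cong (∑ ys (f x) +_) (∑-swap xs ys f)) (≡.sym (∑-+ ys (f x) _))

  ∑-cartesianProduct : ∀ (xs : List A) (ys : List B) (f : A × B → ℕ) →
                       ∑ (cartesianProduct xs ys) f ≡ ∑[ x ∈ xs ] ∑[ y ∈ ys ] f (x , y)
  ∑-cartesianProduct []       ys f = refl
  ∑-cartesianProduct (x ∷ xs) ys f =
    ≡.trans (∑-++ (map (x ,_) ys) _ f) (cong₂ _+_ (∑-map (x ,_) ys f) (∑-cartesianProduct xs ys f))

  length-cartesianProduct : ∀ (xs : List A) (ys : List B) →
                            length (cartesianProduct xs ys) ≡ length xs * length ys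
  length-cartesianProduct []       ys = refl
  length-cartesianProduct (x ∷ xs) ys =
    ≡.trans (length-++ (map (x ,_) ys)) (cong₂ _+_ (length-map (x ,_) ys) (length-cartesianProduct xs ys))

  count≡∑𝟙 : ∀ {p} {P : A → Set p} (P? : UDecidable P) xs → count P? xs ≡ ∑[ x ∈ xs ] 𝟙 (P? x)
  count≡∑𝟙 P? []       = refl
  count≡∑𝟙 P? (x ∷ xs) with P? x
  ... | yes _ = cong suc (count≡∑𝟙 P? xs)
  ... | no  _ = count≡∑𝟙 P? xs

open ListSum

-- Deciding with allFin? (rather than Pointwise.decidable) makes matEq? definitionally
-- the test of pointwiseDecSetoid (pointwiseDecSetoid K d) d, so fiberCount is
-- literally a fibre count.
pointwiseDecSetoid : ∀ {c ℓ} → DecSetoid c ℓ → ℕ → DecSetoid c ℓ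
pointwiseDecSetoid S n = record
  { isDecEquivalence = record
    { isEquivalence = Pointwise.isEquivalence S.isEquivalence n
    ; _≟_           = λ f g → allFin? n (λ i → f i S.≟ g i)
    }
  } where module S = DecSetoid S

record Enumerates {c ℓ p} (S : DecSetoid c ℓ) (P : Pred (DecSetoid.Carrier S) p)
                  (xs : List (DecSetoid.Carrier S)) : Set (c ⊔ ℓ ⊔ p) where
  open DecSetoid S using (_≟_)
  field
    members : All P xs
    once    : ∀ {x} → P x → ∑[ y ∈ xs ] 𝟙 (x ≟ y) ≡ 1

open Enumerates public

record Automorphism {c ℓ p} (S : DecSetoid c ℓ) (P : Pred (DecSetoid.Carrier S) p) : Set (c ⊔ ℓ ⊔ p) where
  open DecSetoid S using (Carrier; _≈_)
  field
    to          : Carrier → Carrier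
    from        : Carrier → Carrier
    to-closed   : ∀ {x} → P x → P (to x)
    from-closed : ∀ {x} → P x → P (from x)
    adjoint     : ∀ {x y} → x ≈ to y ⇔ from x ≈ y

module Enumeration {c ℓ} (S : DecSetoid c ℓ) where
  open DecSetoid S hiding (refl)
  open ≡ using (refl; cong)

  module _ {p} {P : Pred Carrier p} where

    ∑-select : ∀ {f : Carrier → ℕ} → f Preserves _≈_ ⟶ _≡_ → ∀ {ys} → Enumerates S P ys →
               ∀ {x} → P x → ∑[ y ∈ ys ] (𝟙 (x ≟ y) * f y) ≡ f x
    ∑-select {f} f-cong {ys} enum {x} px = begin
        ∑[ y ∈ ys ] (𝟙 (x ≟ y) * f y)  ≡⟨ ∑-cong ys term ⟩
        ∑[ y ∈ ys ] (𝟙 (x ≟ y) * f x)  ≡⟨ ∑-*ʳ ys (λ y → 𝟙 (x ≟ y)) (f x) ⟩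
        ∑[ y ∈ ys ] 𝟙 (x ≟ y) * f x    ≡⟨ cong (_* f x) (once enum px) ⟩
        1 * f x                        ≡⟨ ℕ.*-identityˡ (f x) ⟩
        f x                            ∎
      where
      open ≡.≡-Reasoning
      term : ∀ y → 𝟙 (x ≟ y) * f y ≡ 𝟙 (x ≟ y) * f x
      term y with x ≟ y
      ... | yes x≈y = cong (1 *_) (f-cong (sym x≈y))
      ... | no  _   = refl

    ∑-enumeration-invariant : ∀ {f : Carrier → ℕ} → f Preserves _≈_ ⟶ _≡_ → ∀ {xs ys} →
                              Enumerates S P xs → Enumerates S P ys → ∑ xs f ≡ ∑ ys f
    ∑-enumeration-invariant {f} f-cong {xs} {ys} xs-enum ys-enum = begin
        ∑ xs f
      ≡⟨ ∑-congᴬ (All.map (λ px → ≡.sym (∑-select f-cong ys-enum px)) (members xs-enum)) ⟩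
        ∑[ x ∈ xs ] ∑[ y ∈ ys ] (𝟙 (x ≟ y) * f y)
      ≡⟨ ∑-swap xs ys (λ x y → 𝟙 (x ≟ y) * f y) ⟩
        ∑[ y ∈ ys ] ∑[ x ∈ xs ] (𝟙 (x ≟ y) * f y)
      ≡⟨ ∑-congᴬ (All.map (λ py → ≡.trans (∑-cong xs (λ x → cong (_* _) (𝟙-cong (x ≟ _) (_ ≟ x) (mk⇔ sym sym))))
                                          (∑-select (λ _ → refl) xs-enum py))
                          (members ys-enum)) ⟩
        ∑ ys f ∎
      where open ≡.≡-Reasoning

    map-enumerates : ∀ (π : Automorphism S P) → ∀ {xs} → Enumerates S P xs →
                     Enumerates S P (map (Automorphism.to π) xs)
    map-enumerates π {xs} enum = record
      { members = map⁺ (All.map to-closed (members enum))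
      ; once    = λ {x} px → ≡.trans (∑-map to xs (λ y → 𝟙 (x ≟ y)))
                   (≡.trans (∑-cong xs (λ y → 𝟙-cong (x ≟ to y) (from x ≟ y) adjoint))
                            (once enum (from-closed px)))
      }
      where open Automorphism π

    ∑-reindex : ∀ (π : Automorphism S P) → ∀ {xs} → Enumerates S P xs →
                ∀ {f : Carrier → ℕ} → f Preserves _≈_ ⟶ _≡_ → ∑ xs f ≡ ∑ xs (f ∘ Automorphism.to π)
    ∑-reindex π {xs} enum {f} f-cong =
      ≡.trans (∑-enumeration-invariant f-cong enum (map-enumerates π enum)) (∑-map (Automorphism.to π) xs f)

  filter-enumerates : ∀ {xs} → Enumerates S U xs → ∀ {q} {Q : Pred Carrier q} → Q Respects _≈_ →
                      (Q? : UDecidable Q) → Enumerates S Q (filter Q? xs)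
  filter-enumerates {xs} enum {Q = Q} Q-resp Q? = record
    { members = all-filter Q? xs
    ; once    = λ {x} qx → ≡.trans (∑-filter Q? xs (λ y → 𝟙 (x ≟ y)))
                            (≡.trans (∑-cong xs (term qx)) (once enum _))
    }
    where
    term : ∀ {x} → Q x → ∀ y → 𝟙 (Q? y) * 𝟙 (x ≟ y) ≡ 𝟙 (x ≟ y)
    term {x} qx y with x ≟ y
    ... | no  _   = ℕ.*-zeroʳ (𝟙 (Q? y))
    ... | yes x≈y with Q? y
    ...   | yes _  = refl
    ...   | no ¬qy = ⊥-elim (¬qy (Q-resp x≈y qx))

  distinct-enumerates : ∀ {xs} → AllPairs (λ x y → ¬ x ≈ y) xs → (∀ x → Any (x ≈_) xs) → Enumerates S U xs
  distinct-enumerates {xs} distinct complete = record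
    { members = All.universal-U xs
    ; once    = λ {x} _ → once′ distinct (complete x)
    }
    where
    absent : ∀ {x y zs} → x ≈ y → All (λ z → ¬ y ≈ z) zs → ∑[ z ∈ zs ] 𝟙 (x ≟ z) ≡ 0
    absent                  x≈y []            = refl
    absent {x} {zs = z ∷ _} x≈y (y≉z ∷ y≉zs) with x ≟ z
    ... | yes x≈z = ⊥-elim (y≉z (trans (sym x≈y) x≈z))
    ... | no  _   = absent x≈y y≉zs

    once′ : ∀ {x ys} → AllPairs (λ x y → ¬ x ≈ y) ys → Any (x ≈_) ys → ∑[ y ∈ ys ] 𝟙 (x ≟ y) ≡ 1
    once′ {x} {y ∷ _} (y≉ys ∷ distinct) x∈ys with x ≟ y | x∈ys
    ... | yes x≈y | _           = cong suc (absent x≈y y≉ys)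
    ... | no  x≉y | here x≈y    = ⊥-elim (x≉y x≈y)
    ... | no  _   | there x∈ys′ = once′ distinct x∈ys′

  allFuns-enumerates : ∀ {xs} → Enumerates S U xs → ∀ n →
                       Enumerates (pointwiseDecSetoid S n) U (allFuns n xs)
  allFuns-enumerates {xs} enum n = record
    { members = All.universal-U (allFuns n xs)
    ; once    = λ {g} _ → once′ n g
    }
    where
    𝟙-allFin-suc : ∀ n {p} {Q : Fin (suc n) → Set p} (Q? : ∀ i → Dec (Q i)) →
                   𝟙 (allFin? (suc n) Q?) ≡ 𝟙 (Q? fz) * 𝟙 (allFin? n (Q? ∘ fs))
    𝟙-allFin-suc n Q? with Q? fz | allFin? n (Q? ∘ fs)
    ... | yes _ | yes _ = refl
    ... | yes _ | no  _ = refl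
    ... | no  _ | _     = refl

    once′ : ∀ n (g : Fin n → Carrier) → ∑[ f ∈ allFuns n xs ] 𝟙 (allFin? n (λ i → g i ≟ f i)) ≡ 1
    once′ zero    g = refl
    once′ (suc n) g = begin
        ∑[ f ∈ allFuns (suc n) xs ] 𝟙 (allFin? (suc n) (λ i → g i ≟ f i))
      ≡⟨ ∑-concatMap (λ x → map (cons x) (allFuns n xs)) xs _ ⟩
        ∑[ x ∈ xs ] ∑[ f ∈ map (cons x) (allFuns n xs) ] 𝟙 (allFin? (suc n) (λ i → g i ≟ f i))
      ≡⟨ ∑-cong xs (λ x → ∑-map (cons x) (allFuns n xs) _) ⟩
        ∑[ x ∈ xs ] ∑[ f ∈ allFuns n xs ] 𝟙 (allFin? (suc n) (λ i → g i ≟ cons x f i))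
      ≡⟨ ∑-cong xs (λ x → ∑-cong (allFuns n xs) (λ f → 𝟙-allFin-suc n (λ i → g i ≟ cons x f i))) ⟩
        ∑[ x ∈ xs ] ∑[ f ∈ allFuns n xs ] (𝟙 (g fz ≟ x) * 𝟙 (allFin? n (λ i → g (fs i) ≟ f i)))
      ≡⟨ ∑-cong xs (λ x → ∑-*ˡ (allFuns n xs) (𝟙 (g fz ≟ x)) _) ⟩
        ∑[ x ∈ xs ] (𝟙 (g fz ≟ x) * ∑[ f ∈ allFuns n xs ] 𝟙 (allFin? n (λ i → g (fs i) ≟ f i)))
      ≡⟨ ∑-cong xs (λ x → ≡.trans (cong (𝟙 (g fz ≟ x) *_) (once′ n (g ∘ fs))) (ℕ.*-identityʳ _)) ⟩
        ∑[ x ∈ xs ] 𝟙 (g fz ≟ x)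
      ≡⟨ once enum _ ⟩
        1 ∎
      where open ≡.≡-Reasoning

all-cartesianProduct : ∀ {a b p q} {A : Set a} {B : Set b} {P : Pred A p} {Q : Pred B q} {xs ys} →
                       All P xs → All Q ys → All (P ⟨×⟩ Q) (cartesianProduct xs ys)
all-cartesianProduct []         qys = []
all-cartesianProduct (px ∷ pxs) qys = ++⁺ (map⁺ (All.map (px ,_) qys)) (all-cartesianProduct pxs qys)

cartesianProduct-enumerates : ∀ {c₁ ℓ₁ c₂ ℓ₂ p q} {S₁ : DecSetoid c₁ ℓ₁} {S₂ : DecSetoid c₂ ℓ₂}
  {P : Pred (DecSetoid.Carrier S₁) p} {Q : Pred (DecSetoid.Carrier S₂) q} {xs ys} →
  Enumerates S₁ P xs → Enumerates S₂ Q ys →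
  Enumerates (×-decSetoid S₁ S₂) (P ⟨×⟩ Q) (cartesianProduct xs ys)
cartesianProduct-enumerates {S₁ = S₁} {S₂} {xs = xs} {ys} xs-enum ys-enum = record
  { members = all-cartesianProduct (members xs-enum) (members ys-enum)
  ; once    = λ { {a , b} (pa , qb) → begin
        ∑[ z ∈ cartesianProduct xs ys ] 𝟙 ((a ≟₁ proj₁ z) ×-dec (b ≟₂ proj₂ z))
      ≡⟨ ∑-cartesianProduct xs ys _ ⟩
        ∑[ x ∈ xs ] ∑[ y ∈ ys ] 𝟙 ((a ≟₁ x) ×-dec (b ≟₂ y))
      ≡⟨ ∑-cong xs (λ x → ∑-cong ys (λ y → 𝟙-×-dec (a ≟₁ x) (b ≟₂ y))) ⟩
        ∑[ x ∈ xs ] ∑[ y ∈ ys ] (𝟙 (a ≟₁ x) * 𝟙 (b ≟₂ y))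
      ≡⟨ ∑-cong xs (λ x → ≡.trans (∑-*ˡ ys (𝟙 (a ≟₁ x)) _) (≡.cong (𝟙 (a ≟₁ x) *_) (once ys-enum qb))) ⟩
        ∑[ x ∈ xs ] (𝟙 (a ≟₁ x) * 1)
      ≡⟨ ∑-cong xs (λ x → ℕ.*-identityʳ _) ⟩
        ∑[ x ∈ xs ] 𝟙 (a ≟₁ x)
      ≡⟨ once xs-enum pa ⟩
        1 ∎ }
  }
  where
  open ≡.≡-Reasoning
  open DecSetoid S₁ using () renaming (_≟_ to _≟₁_)
  open DecSetoid S₂ using () renaming (_≟_ to _≟₂_)

module Fibres {c₁ ℓ₁ c₂ ℓ₂} (G : DecSetoid c₁ ℓ₁) (H : DecSetoid c₂ ℓ₂)
  (φ : DecSetoid.Carrier G → DecSetoid.Carrier H)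
  (φ-cong : φ Preserves DecSetoid._≈_ G ⟶ DecSetoid._≈_ H) where
  private
    module G = DecSetoid G
    module H = DecSetoid H

  fibre : List G.Carrier → H.Carrier → ℕ
  fibre gs h = count (λ g → φ g H.≟ h) gs

  ∑-fibre : ∀ gs {hs} → Enumerates H U hs → ∑ hs (fibre gs) ≡ length gs
  ∑-fibre gs {hs} hs-enum = begin
      ∑[ h ∈ hs ] fibre gs h
    ≡⟨ ∑-cong hs (λ h → count≡∑𝟙 (λ g → φ g H.≟ h) gs) ⟩
      ∑[ h ∈ hs ] ∑[ g ∈ gs ] 𝟙 (φ g H.≟ h)
    ≡⟨ ∑-swap hs gs (λ h g → 𝟙 (φ g H.≟ h)) ⟩
      ∑[ g ∈ gs ] ∑[ h ∈ hs ] 𝟙 (φ g H.≟ h)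
    ≡⟨ ∑-cong gs (λ g → once hs-enum _) ⟩
      ∑[ g ∈ gs ] 1
    ≡⟨ ∑-const gs 1 ⟩
      length gs * 1
    ≡⟨ ℕ.*-identityʳ (length gs) ⟩
      length gs ∎
    where open ≡.≡-Reasoning

  fibre-reindex : ∀ {p} {P : Pred G.Carrier p} {gs} → Enumerates G P gs → (π : Automorphism G P) →
                  ∀ {h h′} → (∀ {g} → φ (Automorphism.to π g) H.≈ h ⇔ φ g H.≈ h′) → fibre gs h ≡ fibre gs h′
  fibre-reindex {gs = gs} gs-enum π {h} {h′} shift = begin
      fibre gs h
    ≡⟨ count≡∑𝟙 (λ g → φ g H.≟ h) gs ⟩
      ∑[ g ∈ gs ] 𝟙 (φ g H.≟ h)
    ≡⟨ Enumeration.∑-reindex G π gs-enum (λ g≈g′ → 𝟙-cong (φ _ H.≟ h) (φ _ H.≟ h)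
                                           (mk⇔ (H.trans (H.sym (φ-cong g≈g′))) (H.trans (φ-cong g≈g′)))) ⟩
      ∑[ g ∈ gs ] 𝟙 (φ (to g) H.≟ h)
    ≡⟨ ∑-cong gs (λ g → 𝟙-cong (φ (to g) H.≟ h) (φ g H.≟ h′) shift) ⟩
      ∑[ g ∈ gs ] 𝟙 (φ g H.≟ h′)
    ≡⟨ ≡.sym (count≡∑𝟙 (λ g → φ g H.≟ h′) gs) ⟩
      fibre gs h′ ∎
    where
    open ≡.≡-Reasoning
    open Automorphism π using (to)

  equal-fibres : ∀ gs {hs} → Enumerates H U hs → ∀ h₀ → (∀ h → fibre gs h ≡ fibre gs h₀) →
                 fibre gs h₀ * length hs ≡ length gs
  equal-fibres gs {hs} hs-enum h₀ homogeneous = begin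
      fibre gs h₀ * length hs
    ≡⟨ ℕ.*-comm (fibre gs h₀) (length hs) ⟩
      length hs * fibre gs h₀
    ≡⟨ ≡.sym (∑-const hs (fibre gs h₀)) ⟩
      ∑[ _ ∈ hs ] fibre gs h₀
    ≡⟨ ≡.sym (∑-cong hs homogeneous) ⟩
      ∑ hs (fibre gs)
    ≡⟨ ∑-fibre gs hs-enum ⟩
      length gs ∎
    where open ≡.≡-Reasoning

module RangeSum {c ℓ} (M : CommutativeMonoid c ℓ) where
  open import Data.Nat using (_+_)
  open CommutativeMonoid M
  open import Relation.Binary.Reasoning.Setoid setoid

  ∑< : ℕ → (ℕ → Carrier) → Carrier
  ∑< zero    f = ε
  ∑< (suc n) f = ∑< n f ∙ f n

  ∑<-cong : ∀ n {f g} → (∀ {i} → i < n → f i ≈ g i) → ∑< n f ≈ ∑< n g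
  ∑<-cong zero    _   = refl
  ∑<-cong (suc n) f≈g = ∙-cong (∑<-cong n (f≈g ∘ ℕ.m<n⇒m<1+n)) (f≈g (ℕ.n<1+n n))

  ∑<-suc : ∀ n f → ∑< (suc n) f ≈ f 0 ∙ ∑< n (f ∘ suc)
  ∑<-suc zero    f = trans (identityˡ (f 0)) (sym (identityʳ (f 0)))
  ∑<-suc (suc n) f = trans (∙-congʳ (∑<-suc n f)) (assoc (f 0) _ _)

  ∑<-+ : ∀ m n f → ∑< (n + m) f ≈ ∑< m f ∙ ∑< n (λ i → f (m + i))
  ∑<-+ m zero    f = sym (identityʳ _)
  ∑<-+ m (suc n) f = trans (∙-cong (∑<-+ m n f) (reflexive (≡.cong f (ℕ.+-comm n m)))) (assoc _ _ _)

  -- In characteristic 2 the diagonal hypothesis does not follow from the other one.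
  ∑<-antidiagonal≈ε : ∀ (B : ℕ → ℕ → Carrier) → (∀ x → B x x ≈ ε) → (∀ x y → B x y ∙ B y x ≈ ε) →
                      ∀ n → ∑< n (λ i → B (n ∸ suc i) i) ≈ ε
  ∑<-antidiagonal≈ε B diag skew zero          = refl
  ∑<-antidiagonal≈ε B diag skew (suc zero)    = trans (identityˡ _) (diag 0)
  ∑<-antidiagonal≈ε B diag skew (suc (suc n)) = begin
      ∑< (suc n) (λ i → B (suc n ∸ i) i) ∙ B (suc n ∸ suc n) (suc n)
    ≈⟨ ∙-cong (∑<-suc n _) (reflexive (≡.cong (λ x → B x (suc n)) (ℕ.n∸n≡0 n))) ⟩
      (B (suc n) 0 ∙ ∑< n (λ i → B (n ∸ i) (suc i))) ∙ B 0 (suc n)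
    ≈⟨ ∙-congʳ (∙-congˡ inner) ⟩
      (B (suc n) 0 ∙ ε) ∙ B 0 (suc n)
    ≈⟨ ∙-congʳ (identityʳ _) ⟩
      B (suc n) 0 ∙ B 0 (suc n)
    ≈⟨ skew (suc n) 0 ⟩
      ε ∎
    where
    inner : ∑< n (λ i → B (n ∸ i) (suc i)) ≈ ε
    inner = trans (∑<-cong n (λ {i} i<n → reflexive (≡.cong (λ x → B x (suc i)) (ℕ.+-∸-assoc 1 i<n))))
                  (∑<-antidiagonal≈ε (λ x y → B (suc x) (suc y)) (diag ∘ suc)
                                     (λ x y → skew (suc x) (suc y)) n)

module AbelianGroupIdentities {a ℓ} (G : AbelianGroup a ℓ) where
  open AbelianGroup G
  open import Algebra.Properties.AbelianGroup G using (⁻¹-anti-homo‿-; ⁻¹-∙-comm; xyx⁻¹≈y)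
  open import Algebra.Properties.CommutativeSemigroup commutativeSemigroup using (x∙yz≈y∙xz)
  open import Relation.Binary.Reasoning.Setoid setoid

  x-y∙y-x≈ε : ∀ x y → (x - y) ∙ (y - x) ≈ ε
  x-y∙y-x≈ε x y = trans (∙-congˡ (sym (⁻¹-anti-homo‿- x y))) (inverseʳ (x - y))

  x-[p∙x-y]≈y-p : ∀ x y p → x - (p ∙ (x - y)) ≈ y - p
  x-[p∙x-y]≈y-p x y p = begin
    x ∙ (p ∙ (x - y)) ⁻¹      ≈⟨ ∙-congˡ (sym (⁻¹-∙-comm p (x - y))) ⟩
    x ∙ (p ⁻¹ ∙ (x - y) ⁻¹)   ≈⟨ ∙-congˡ (∙-congˡ (⁻¹-anti-homo‿- x y)) ⟩
    x ∙ (p ⁻¹ ∙ (y - x))      ≈⟨ x∙yz≈y∙xz x (p ⁻¹) (y - x) ⟩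
    p ⁻¹ ∙ (x ∙ (y - x))      ≈⟨ ∙-congˡ (trans (sym (assoc x y (x ⁻¹))) (xyx⁻¹≈y x y)) ⟩
    p ⁻¹ ∙ y                  ≈⟨ comm (p ⁻¹) y ⟩
    y - p                     ∎

module CyclicSolution {c ℓ} (F : FiniteField c ℓ) (n : ℕ) (M : Mat F (suc n)) where
  open FiniteField F
  open AbelianGroupIdentities +-abelianGroup using (x-y∙y-x≈ε; x-[p∙x-y]≈y-p)
  open RangeSum +-commutativeMonoid using (∑<; ∑<-cong; ∑<-+; ∑<-antidiagonal≈ε)
  open import Algebra.Properties.Group +-group using (//-rightDividesˡ)
  open import Relation.Binary.Reasoning.Setoid setoid

  m : ℕ → ℕ → Carrier
  m x y = M (x mod suc n) (y mod suc n)

  skew : ℕ → ℕ → Carrier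
  skew x y = m x y - m y x

  antidiagonal : ℕ → ℕ → Carrier
  antidiagonal s a = ∑< a (λ k → skew (s ∸ suc k) k)

  Y : ℕ → ℕ → Carrier
  Y a b = antidiagonal (a ℕ.+ b) a

  mod-toℕ : ∀ (i : Fin (suc n)) → toℕ i mod suc n ≡ i
  mod-toℕ i = ≡.trans (fromℕ<-cong _ _ (m<n⇒m%n≡m (toℕ<n i)) _ (toℕ<n i)) (fromℕ<-toℕ i _)

  skew-toℕ : ∀ i j → skew (toℕ i) (toℕ j) ≡ M i j - M j i
  skew-toℕ i j = ≡.cong₂ (λ u v → M u v - M v u) (mod-toℕ i) (mod-toℕ j)

  skew-periodic : ∀ x y → skew (x ℕ.+ suc n) y ≡ skew x y
  skew-periodic x y = ≡.cong (λ i → M i (y mod suc n) - M (y mod suc n) i)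
                             (fromℕ<-cong _ _ ([m+n]%n≡m%n x (suc n)) _ _)

  Y-suc : ∀ a b → Y (suc a) b ≡ Y a (suc b) + skew b a
  Y-suc a b = ≡.cong₂ _+_ (≡.cong (λ s → antidiagonal s a) (≡.sym (ℕ.+-suc a b)))
                          (≡.cong (λ x → skew x a) (ℕ.m+n∸m≡n a b))

  antidiagonal-index : ∀ {l a i} → i < l → (l ℕ.+ a) ℕ.+ a ∸ suc (a ℕ.+ i) ≡ a ℕ.+ (l ∸ suc i)
  antidiagonal-index {a = a} {i} i<l with ℕ.m≤n⇒∃[o]m+o≡n i<l
  ... | k , ≡.refl = ≡.trans (≡.cong (_∸ suc (a ℕ.+ i)) (rearrange i k a))
                             (≡.trans (ℕ.m+n∸m≡n (suc (a ℕ.+ i)) (a ℕ.+ k))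
                                      (≡.cong (a ℕ.+_) (≡.sym (ℕ.m+n∸m≡n (suc i) k))))
    where
    rearrange : ∀ i k a → (suc i ℕ.+ k ℕ.+ a) ℕ.+ a ≡ suc (a ℕ.+ i) ℕ.+ (a ℕ.+ k)
    rearrange = ℕ-solve-∀

  ∑-skew-antidiagonal≈0 : ∀ a l → ∑< l (λ i → skew (a ℕ.+ (l ∸ suc i)) (a ℕ.+ i)) ≈ 0#
  ∑-skew-antidiagonal≈0 a l = ∑<-antidiagonal≈ε (λ x y → skew (a ℕ.+ x) (a ℕ.+ y))
    (λ x → -‿inverseʳ (m (a ℕ.+ x) (a ℕ.+ x)))
    (λ x y → x-y∙y-x≈ε (m (a ℕ.+ x) (a ℕ.+ y)) (m (a ℕ.+ y) (a ℕ.+ x))) l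

  Y-symmetric-+ : ∀ a l → Y a (l ℕ.+ a) ≈ Y (l ℕ.+ a) a
  Y-symmetric-+ a l = sym (begin
      antidiagonal ((l ℕ.+ a) ℕ.+ a) (l ℕ.+ a)
    ≈⟨ ∑<-+ a l _ ⟩
      antidiagonal ((l ℕ.+ a) ℕ.+ a) a + ∑< l (λ i → skew ((l ℕ.+ a) ℕ.+ a ∸ suc (a ℕ.+ i)) (a ℕ.+ i))
    ≈⟨ +-congˡ (∑<-cong l (λ {i} i<l → reflexive (≡.cong (λ x → skew x (a ℕ.+ i)) (antidiagonal-index i<l)))) ⟩
      antidiagonal ((l ℕ.+ a) ℕ.+ a) a + ∑< l (λ i → skew (a ℕ.+ (l ∸ suc i)) (a ℕ.+ i))
    ≈⟨ +-congˡ (∑-skew-antidiagonal≈0 a l) ⟩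
      antidiagonal ((l ℕ.+ a) ℕ.+ a) a + 0#
    ≈⟨ +-identityʳ _ ⟩
      antidiagonal ((l ℕ.+ a) ℕ.+ a) a
    ≡⟨ ≡.cong (λ s → antidiagonal s a) (ℕ.+-comm (l ℕ.+ a) a) ⟩
      Y a (l ℕ.+ a) ∎)

  Y-symmetric : ∀ a b → Y a b ≈ Y b a
  Y-symmetric a b with ℕ.≤-total a b
  ... | inj₁ a≤b = ≡.subst (λ b → Y a b ≈ Y b a) (ℕ.m∸n+n≡m a≤b) (Y-symmetric-+ a (b ∸ a))
  ... | inj₂ b≤a = sym (≡.subst (λ a → Y b a ≈ Y a b) (ℕ.m∸n+n≡m b≤a) (Y-symmetric-+ b (a ∸ b)))

  Y-periodic : ∀ a b → Y a (b ℕ.+ suc n) ≈ Y a b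
  Y-periodic a b = ∑<-cong a (λ {k} k<a →
    reflexive (≡.trans (≡.cong (λ x → skew x k) (index k<a)) (skew-periodic (a ℕ.+ b ∸ suc k) k)))
    where
    index : ∀ {k} → k < a → a ℕ.+ (b ℕ.+ suc n) ∸ suc k ≡ (a ℕ.+ b ∸ suc k) ℕ.+ suc n
    index {k} k<a = ≡.trans (≡.cong (_∸ suc k) (≡.sym (ℕ.+-assoc a b (suc n))))
                            (ℕ.+-∸-comm (suc n) (ℕ.≤-trans k<a (ℕ.m≤m+n a b)))

  Y-next : ∀ a (j : Fin (suc n)) → Y a (toℕ (next j)) ≈ Y a (suc (toℕ j))
  Y-next a j with ℕ.m≤n⇒m<n∨m≡n (ℕ.s≤s⁻¹ (toℕ<n j))
  ... | inj₁ j<n = reflexive (≡.cong (Y a) (≡.trans (toℕ-fromℕ< _) (m<n⇒m%n≡m (s≤s j<n))))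
  ... | inj₂ j≡n = begin
      Y a (toℕ (next j))
    ≡⟨ ≡.cong (Y a) (≡.trans (toℕ-fromℕ< _) (≡.trans (≡.cong (λ x → suc x % suc n) j≡n) (n%n≡0 (suc n)))) ⟩
      Y a 0
    ≈⟨ sym (Y-periodic a 0) ⟩
      Y a (suc n)
    ≡⟨ ≡.cong (Y a ∘ suc) (≡.sym j≡n) ⟩
      Y a (suc (toℕ j)) ∎

  Yᶠ : Mat F (suc n)
  Yᶠ i j = Y (toℕ i) (toℕ j)

  Xᶠ : Mat F (suc n)
  Xᶠ i j = M i j - Yᶠ i (next j)

  Yᶠ-symmetric : Symmetric F Yᶠ
  Yᶠ-symmetric i j = Y-symmetric (toℕ i) (toℕ j)

  Xᶠ-symmetric : Symmetric F Xᶠ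
  Xᶠ-symmetric i j = begin
      M i j - Yᶠ i (next j)
    ≈⟨ +-congˡ (-‿cong (Y-next a j)) ⟩
      M i j - Y a (suc b)
    ≈⟨ sym (x-[p∙x-y]≈y-p (M j i) (M i j) (Y a (suc b))) ⟩
      M j i - (Y a (suc b) + (M j i - M i j))
    ≡⟨ ≡.cong (λ y → M j i - y) (≡.sym (≡.trans (Y-suc a b) (≡.cong (Y a (suc b) +_) (skew-toℕ j i)))) ⟩
      M j i - Y (suc a) b
    ≈⟨ +-congˡ (-‿cong (trans (Y-symmetric (suc a) b) (sym (Y-next b i)))) ⟩
      M j i - Yᶠ j (next i) ∎
    where
    a = toℕ i
    b = toℕ j

  Zmat-Xᶠ-Yᶠ≈M : MatEq F (Zmat F Xᶠ Yᶠ) M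
  Zmat-Xᶠ-Yᶠ≈M i j = //-rightDividesˡ (Yᶠ i (next j)) (M i j)

Zmat-surjective : ∀ {c ℓ} (F : FiniteField c ℓ) d (M : Mat F d) →
  ∃ λ ((X , Y) : Mat F d × Mat F d) → Symmetric F X × Symmetric F Y × MatEq F (Zmat F X Y) M
Zmat-surjective F zero    M = ((λ ()) , (λ ())) , (λ ()) , (λ ()) , (λ ())
Zmat-surjective F (suc n) M = (Xᶠ , Yᶠ) , Xᶠ-symmetric , Yᶠ-symmetric , Zmat-Xᶠ-Yᶠ≈M
  where open CyclicSolution F n M

module SymmetricPairs {c ℓ} (F : FiniteField c ℓ) (d : ℕ) where
  open FiniteField F
  open import Algebra.Properties.Group +-group using (x≈z//y; //-rightDividesˡ; identityˡ-unique)
  open import Algebra.Properties.CommutativeSemigroup +-commutativeSemigroup using (interchange)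

  entries : DecSetoid c ℓ
  entries = record { isDecEquivalence = record { isEquivalence = isEquivalence ; _≟_ = _≟_ } }

  matrices : DecSetoid c ℓ
  matrices = pointwiseDecSetoid (pointwiseDecSetoid entries d) d

  matrixPairs : DecSetoid c ℓ
  matrixPairs = ×-decSetoid matrices matrices

  allMats-enumerates : Enumerates matrices U (allMats F d)
  allMats-enumerates = allFuns-enumerates (pointwiseDecSetoid entries d)
    (allFuns-enumerates entries (distinct-enumerates entries distinct complete) d) d
    where open Enumeration

  symMats-enumerates : Enumerates matrices (Symmetric F) (symMats F d)
  symMats-enumerates = Enumeration.filter-enumerates matrices allMats-enumerates
    (λ A≈B sA i j → trans (sym (A≈B i j)) (trans (sA i j) (A≈B j i))) (symmetric? F)

  symPairs : List (Mat F d × Mat F d)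
  symPairs = cartesianProduct (symMats F d) (symMats F d)

  symPairs-enumerates : Enumerates matrixPairs (Symmetric F ⟨×⟩ Symmetric F) symPairs
  symPairs-enumerates = cartesianProduct-enumerates symMats-enumerates symMats-enumerates

  Z : Mat F d × Mat F d → Mat F d
  Z = uncurry (Zmat F)

  Z-cong : Z Preserves DecSetoid._≈_ matrixPairs ⟶ MatEq F
  Z-cong (X≈X′ , Y≈Y′) i j = +-cong (X≈X′ i j) (Y≈Y′ i (next j))

  open Fibres matrixPairs matrices Z Z-cong public

  _⊞_ : Mat F d → Mat F d → Mat F d
  (A ⊞ B) i j = A i j + B i j

  _⊟_ : Mat F d → Mat F d → Mat F d
  (A ⊟ B) i j = A i j - B i j

  0ᴹ : Mat F d
  0ᴹ i j = 0#

  ⊞-symmetric : ∀ {A B} → Symmetric F A → Symmetric F B → Symmetric F (A ⊞ B)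
  ⊞-symmetric sA sB i j = +-cong (sA i j) (sB i j)

  ⊟-symmetric : ∀ {A B} → Symmetric F A → Symmetric F B → Symmetric F (A ⊟ B)
  ⊟-symmetric sA sB i j = +-cong (sA i j) (-‿cong (sB i j))

  ≈+⇔-≈ : ∀ {a x t} → a ≈ x + t ⇔ a - t ≈ x
  ≈+⇔-≈ {a} {x} {t} = mk⇔ (λ a≈x+t → sym (x≈z//y x t a (sym a≈x+t)))
                            (λ a-t≈x → trans (sym (//-rightDividesˡ t a)) (+-congʳ a-t≈x))

  ⊞⇔⊟ : ∀ {A X T} → MatEq F A (X ⊞ T) ⇔ MatEq F (A ⊟ T) X
  ⊞⇔⊟ = mk⇔ (λ A≈X⊞T i j → Equivalence.to ≈+⇔-≈ (A≈X⊞T i j))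
            (λ A⊟T≈X i j → Equivalence.from ≈+⇔-≈ (A⊟T≈X i j))

  +≈⇔≈0 : ∀ {u v m} → v ≈ m → u + v ≈ m ⇔ u ≈ 0#
  +≈⇔≈0 {u} {v} v≈m = mk⇔ (λ u+v≈m → identityˡ-unique u v (trans u+v≈m (sym v≈m)))
                            (λ u≈0 → trans (+-congʳ u≈0) (trans (+-identityˡ v) v≈m))

  translation : ∀ {X₀ Y₀} → Symmetric F X₀ → Symmetric F Y₀ →
                Automorphism matrixPairs (Symmetric F ⟨×⟩ Symmetric F)
  translation {X₀} {Y₀} X₀-sym Y₀-sym = record
    { to          = Product.map (_⊞ X₀) (_⊞ Y₀)
    ; from        = Product.map (_⊟ X₀) (_⊟ Y₀)
    ; to-closed   = Product.map (λ sX → ⊞-symmetric sX X₀-sym) (λ sY → ⊞-symmetric sY Y₀-sym)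
    ; from-closed = Product.map (λ sX → ⊟-symmetric sX X₀-sym) (λ sY → ⊟-symmetric sY Y₀-sym)
    ; adjoint     = mk⇔ (Product.map (Equivalence.to ⊞⇔⊟) (Equivalence.to ⊞⇔⊟))
                        (Product.map (Equivalence.from ⊞⇔⊟) (Equivalence.from ⊞⇔⊟))
    }

  Zmat-translate : ∀ {X₀ Y₀ M} → MatEq F (Zmat F X₀ Y₀) M →
                   ∀ {X Y} → MatEq F (Zmat F (X ⊞ X₀) (Y ⊞ Y₀)) M ⇔ MatEq F (Zmat F X Y) 0ᴹ
  Zmat-translate Z₀≈M = mk⇔
    (λ Z≈M i j → Equivalence.to (+≈⇔≈0 (Z₀≈M i j)) (trans (sym (interchange _ _ _ _)) (Z≈M i j)))
    (λ Z≈0 i j → trans (interchange _ _ _ _) (Equivalence.from (+≈⇔≈0 (Z₀≈M i j)) (Z≈0 i j)))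

  fibre≡fibre-0ᴹ : ∀ M → fibre symPairs M ≡ fibre symPairs 0ᴹ
  fibre≡fibre-0ᴹ M with Zmat-surjective F d M
  ... | (X₀ , Y₀) , X₀-sym , Y₀-sym , Z₀≈M = fibre-reindex symPairs-enumerates (translation X₀-sym Y₀-sym)
    (λ {(X , Y)} → Zmat-translate {X₀} {Y₀} Z₀≈M {X} {Y})

claim3p6 : ∀ {c ℓ} (F : FiniteField c ℓ) (d : ℕ) (M : Mat F d) →
    fiberCount F d M * length (allMats F d) ≡ length (symMats F d) * length (symMats F d)
claim3p6 F d M = ≡.trans
  (equal-fibres symPairs allMats-enumerates M λ M′ → ≡.trans (fibre≡fibre-0ᴹ M′) (≡.sym (fibre≡fibre-0ᴹ M)))
  (length-cartesianProduct (symMats F d) (symMats F d))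
  where open SymmetricPairs F d
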